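{- Let $n\ge 2$ and $2\le i\le n$. The number of $x\in\mathsf{Pop}_{\mathrm{Weak}(B_n)}(\mathrm{Weak}(B_n))$ with $x_1=i$ and $|\mathscr{U}_{\mathrm{Weak}(B_n)}(x)|=n-1$ is $2^{i-1}\cdot 3^{n-i}$.
   Context: $B_n$ is the set of permutations $x=x_1\cdots x_{2n}$ of $\{1,\dots,2n\}$ with $x_i+x_{2n+1-i}=2n+1$ for all $i$; $\mathrm{Weak}(B_n)$ is $B_n$ with the right weak order ($x\le y$ iff every pair of values $a<b$ with $b$ before $a$ in $x$ also has $b$ before $a$ in $y$). For a finite lattice $M$, $\mathsf{Pop}_M(x)$ is the meet of $x$ and all elements it covers (in $\mathrm{Weak}(B_n)$: reverse each maximal descending run of $x$), $\mathsf{Pop}_M(M)$ is its image, and $\mathscr{U}_M(x)$ is the set of elements covering $x$; in $\mathrm{Weak}(B_n)$, $|\mathscr{U}(x)|=\#\{i\in\{1,\dots,n\}:x_i<x_{i+1}\}$. -}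

module Defs where

open import Data.Nat using (ℕ; zero; suc; _+_; _*_; _<ᵇ_)
open import Data.Bool using (if_then_else_)
open import Data.List using (List; []; _∷_; length; reverse; zipWith; replicate; concatMap; take; upTo; map)
open import Data.List.Relation.Binary.Permutation.Propositional using (_↭_)
open import Data.Product using (_×_; Σ)
open import Relation.Binary.PropositionalEquality using (_≡_)

-- Words are lists of naturals x = x₁ ⋯ x_{2n} (1-indexed values).

oneTo : ℕ → List ℕ
oneTo m = map suc (upTo m)

B : ℕ → List ℕ → Set
B n x = (x ↭ oneTo (2 * n)) × (zipWith _+_ x (reverse x) ≡ replicate (2 * n) (suc (2 * n)))

descRuns : List ℕ → List (List ℕ)
descRuns [] = []
descRuns (a ∷ xs) with descRuns xs
... | [] = (a ∷ []) ∷ []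
... | [] ∷ rs = (a ∷ []) ∷ [] ∷ rs
... | (b ∷ r) ∷ rs = if b <ᵇ a then (a ∷ b ∷ r) ∷ rs else (a ∷ []) ∷ (b ∷ r) ∷ rs

pop : List ℕ → List ℕ
pop x = concatMap reverse (descRuns x)

InPopImage : ℕ → List ℕ → Set
InPopImage n x = Σ (List ℕ) (λ y → B n y × (pop y ≡ x))

ascents : List ℕ → ℕ
ascents [] = 0
ascents (a ∷ []) = 0
ascents (a ∷ b ∷ r) = (if a <ᵇ b then 1 else 0) + ascents (b ∷ r)

-- |U(x)| in Weak(B_n) = #{ i ∈ {1,…,n} : x_i < x_{i+1} }
upperCovers : ℕ → List ℕ → ℕ
upperCovers n x = ascents (take (suc n) x)

{-# OPTIONS --safe #-}
-- Write v̄ = 2n+1−v and mirror w for the reverse of the word of bars of w.  Elements of B_n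
-- are the permutations x with mirror x = x, and Pop commutes with mirror, so every x in the
-- image of Pop is h ++ mirror h for its first half h.  If moreover x₁ = i and x₁⋯x_{n+1}
-- has n−1 ascents, then h = A ++ C where A is the increasing run starting at i and C is an
-- increasing run of letters ≤ n entered by a descent.  Conversely such a word is Pop of
-- reverse A ++ reverse (C ++ mirror C) ++ mirror (reverse A).  The word is thus determined
-- by the role of each letter v ≤ n: v ∈ A, v ∈ C, or v̄ ∈ A.  Letters below i cannot lie
-- in A, the letter i must, and letters above i may play any role: 2^(i−1)·3^(n−i) words.
module Submission where

open import Defs
open import Data.Bool using (true; false; if_then_else_)
open import Data.Empty using (⊥)
open import Data.List using (List; []; _∷_; _++_; _∷ʳ_; length; reverse; reverseAcc; map; concat; concatMap; head; last; take; drop; filter; zipWith; replicate; upTo; applyUpTo; cartesianProductWith)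
open import Data.List.Properties
open import Data.List.Membership.Propositional using (_∈_; _∉_)
open import Data.List.Membership.Propositional.Properties using (∈-map⁺; ∈-map⁻; ∈-filter⁺; ∈-filter⁻; ∈-upTo⁺; ∈-upTo⁻; ∈-++⁺ˡ; ∈-++⁺ʳ; ∈-++⁻; ∈-cartesianProductWith⁺; ∈-cartesianProductWith⁻)
open import Data.List.Relation.Binary.Permutation.Propositional using (_↭_; ↭-refl; ↭-sym; ↭-trans; ↭-prep; ↭-reflexive; ↭⇒↭ₛ; module PermutationReasoning)
open import Data.List.Relation.Binary.Permutation.Propositional.Properties using (++⁺; shift; ↭-reverse; ∈-resp-↭; All-resp-↭; ↭-length)
import Data.List.Relation.Binary.Permutation.Propositional.Properties as ↭
open import Data.List.Relation.Unary.All using (All; []; _∷_)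
import Data.List.Relation.Unary.All as All
import Data.List.Relation.Unary.All.Properties as All
import Data.List.Relation.Unary.AllPairs as AllPairs
open import Data.List.Relation.Unary.Any using (here; there)
open import Data.List.Relation.Unary.Linked using (Linked; []; [-]; _∷_)
import Data.List.Relation.Unary.Linked as Linked
import Data.List.Relation.Unary.Linked.Properties as Linked
open import Data.List.Relation.Unary.Unique.Propositional using (Unique; []; _∷_)
import Data.List.Relation.Unary.Unique.Propositional.Properties as Unique
open import Data.Maybe using (just)
import Data.Maybe as Maybe
open import Data.Nat using (ℕ; zero; suc; _+_; _*_; _^_; _∸_; _≤_; _<_; _>_; _⊓_; _<ᵇ_; z≤n; s≤s; _≤?_)
open import Data.Nat.ListAction using (product)
open import Data.Nat.ListAction.Properties using (product-++)
open import Data.Nat.Properties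
open import Data.Product using (Σ; ∃; _×_; _,_; proj₁; proj₂; map₁; uncurry)
open import Data.Sum using (_⊎_; inj₁; inj₂)
open import Data.Unit using (⊤; tt)
open import Function using (flip; _∘_)
open import Function.Bundles using (_⇔_; mk⇔)
open import Relation.Binary.Definitions using (DecidableEquality; tri<; tri≈; tri>)
open import Relation.Binary.PropositionalEquality
open import Relation.Nullary using (yes; no; contradiction)
open import Relation.Nullary.Reflects using (ofʸ; ofⁿ)
open import Algebra.Solver.CommutativeMonoid (↭.++-commutativeMonoid {A = ℕ}) using (solve; _⊕_; _⊜_)
open import Data.List.Membership.DecPropositional _≟_ using (_∈?_)
import Data.List.Relation.Binary.Permutation.Setoid.Properties (setoid ℕ) as PermutationₛProperties

<ᵇ-true : ∀ {m n} → m < n → (m <ᵇ n) ≡ true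
<ᵇ-true {m} {n} m<n with m <ᵇ n | <ᵇ-reflects-< m n
... | true  | _ = refl
... | false | ofⁿ m≮n = contradiction m<n m≮n

<ᵇ-false : ∀ {m n} → n ≤ m → (m <ᵇ n) ≡ false
<ᵇ-false {m} {n} n≤m with m <ᵇ n | <ᵇ-reflects-< m n
... | true  | ofʸ m<n = contradiction n≤m (<⇒≱ m<n)
... | false | _ = refl

last-∷ʳ : ∀ {A : Set} (xs : List A) x → last (xs ∷ʳ x) ≡ just x
last-∷ʳ []           x = refl
last-∷ʳ (y ∷ [])     x = refl
last-∷ʳ (y ∷ z ∷ xs) x = last-∷ʳ (z ∷ xs) x

last-reverse : ∀ {A : Set} (xs : List A) → last (reverse xs) ≡ head xs
last-reverse []       = refl
last-reverse (x ∷ xs) = trans (cong last (unfold-reverse x xs)) (last-∷ʳ (reverse xs) x)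

head-reverse : ∀ {A : Set} (xs : List A) → head (reverse xs) ≡ last xs
head-reverse xs = trans (sym (last-reverse (reverse xs))) (cong last (reverse-involutive xs))

reverse-∷≢[] : ∀ {A : Set} (x : A) xs → reverse (x ∷ xs) ≢ []
reverse-∷≢[] x xs eq with () ← trans (sym (last-reverse (x ∷ xs))) (cong last eq)

last-++ : ∀ {A : Set} (xs : List A) {ys} → ys ≢ [] → last (xs ++ ys) ≡ last ys
last-++ []            _  = refl
last-++ (x ∷ [])      {[]}    ys≢[] = contradiction refl ys≢[]
last-++ (x ∷ [])      {y ∷ _} _     = refl
last-++ (x ∷ x′ ∷ xs) ys≢[] = last-++ (x′ ∷ xs) ys≢[]

take-++-length : ∀ {X : Set} (xs ys : List X) k → take (length xs + k) (xs ++ ys) ≡ xs ++ take k ys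
take-++-length []       ys k = refl
take-++-length (x ∷ xs) ys k = cong (x ∷_) (take-++-length xs ys k)

take-1 : ∀ {X : Set} {xs : List X} {x} → head xs ≡ just x → take 1 xs ≡ x ∷ []
take-1 {xs = y ∷ _} refl = refl

++-cancel-length : ∀ {X : Set} (p r : List X) {q s} → length p ≡ length r → p ++ q ≡ r ++ s → p ≡ r × q ≡ s
++-cancel-length []      []      _   eq = refl , eq
++-cancel-length (x ∷ p) (y ∷ r) len eq with refl ← ∷-injectiveˡ eq
  with refl , q≡s ← ++-cancel-length p r (suc-injective len) (∷-injectiveʳ eq) = refl , q≡s

unique-++ˡ : ∀ {X : Set} {xs ys : List X} → Unique (xs ++ ys) → Unique xs
unique-++ˡ {xs = []}     _         = []
unique-++ˡ {xs = x ∷ xs} (x∉ ∷ u) = All.++⁻ˡ xs x∉ ∷ unique-++ˡ u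

unique-++-disjoint : ∀ {X : Set} {xs ys : List X} {v} → Unique (xs ++ ys) → v ∈ xs → v ∈ ys → ⊥
unique-++-disjoint {xs = x ∷ xs} (x∉ ∷ _) (here refl) v∈ys = All.lookup x∉ (∈-++⁺ʳ xs v∈ys) refl
unique-++-disjoint {xs = x ∷ xs} (_ ∷ u)  (there v∈xs) v∈ys = unique-++-disjoint u v∈xs v∈ys

Linked-reverse : ∀ {A : Set} {R : A → A → Set} {l} → Linked R l → Linked (flip R) (reverse l)
Linked-reverse {l = []}    _ = []
Linked-reverse {l = a ∷ l} r = go r [-]
  where
  go : ∀ {A : Set} {R : A → A → Set} {a l acc} → Linked R (a ∷ l) → Linked (flip R) (a ∷ acc) →
       Linked (flip R) (reverseAcc (a ∷ acc) l)
  go [-]      racc = racc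
  go (r ∷ rs) racc = go rs (r ∷ racc)

-- Increasing lists

Increasing : List ℕ → Set
Increasing = Linked _<_

lastOf : ℕ → List ℕ → ℕ
lastOf a []      = a
lastOf a (b ∷ l) = lastOf b l

lastOf-∈ : ∀ a l → lastOf a l ∈ a ∷ l
lastOf-∈ a []      = here refl
lastOf-∈ a (b ∷ l) = there (lastOf-∈ b l)

last-∷ : ∀ a l → last (a ∷ l) ≡ just (lastOf a l)
last-∷ a []      = refl
last-∷ a (b ∷ l) = last-∷ b l

lastOf-++ : ∀ a A C → lastOf a (A ++ C) ≡ lastOf (lastOf a A) C
lastOf-++ a []      C = refl
lastOf-++ a (b ∷ A) C = lastOf-++ b A C

increasing-head< : ∀ {a l v} → Increasing (a ∷ l) → v ∈ l → a < v
increasing-head< (a<b ∷ _)  (here refl) = a<b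
increasing-head< (a<b ∷ bl) (there v∈l) = <-trans a<b (increasing-head< bl v∈l)

increasing-head≤ : ∀ {a l v} → Increasing (a ∷ l) → v ∈ a ∷ l → a ≤ v
increasing-head≤ _  (here refl)  = ≤-refl
increasing-head≤ al (there v∈l) = <⇒≤ (increasing-head< al v∈l)

increasing-≤lastOf : ∀ {a l v} → Increasing (a ∷ l) → v ∈ a ∷ l → v ≤ lastOf a l
increasing-≤lastOf {a} {[]}    _         (here refl) = ≤-refl
increasing-≤lastOf {a} {b ∷ l} (a<b ∷ bl) (here refl) =
  ≤-trans (<⇒≤ a<b) (increasing-head≤ bl (lastOf-∈ b l))
increasing-≤lastOf {a} {b ∷ l} (_ ∷ bl)  (there v∈bl) = increasing-≤lastOf bl v∈bl

increasing-unique : ∀ {l} → Increasing l → Unique l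
increasing-unique inc = AllPairs.map (λ u<v u≡v → <-irrefl u≡v u<v) (Linked.Linked⇒AllPairs <-trans inc)

increasing-++ : ∀ {l m} → Increasing l → Increasing m → (∀ {u v} → u ∈ l → v ∈ m → u < v) →
                Increasing (l ++ m)
increasing-++ {[]}            _          inc-m _  = inc-m
increasing-++ {a ∷ []} {[]}    _          _     _  = [-]
increasing-++ {a ∷ []} {b ∷ m} _          inc-m lt = lt (here refl) (here refl) ∷ inc-m
increasing-++ {a ∷ b ∷ l}      (a<b ∷ bl) inc-m lt = a<b ∷ increasing-++ bl inc-m (lt ∘ there)

increasing-∷ʳ⁻ : ∀ {a l z} → Increasing (a ∷ l ++ z ∷ []) → Increasing (a ∷ l) × lastOf a l < z
increasing-∷ʳ⁻ {l = []}    (a<z ∷ _)  = [-] , a<z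
increasing-∷ʳ⁻ {l = b ∷ l} (a<b ∷ bl) with inc , last<z ← increasing-∷ʳ⁻ bl = a<b ∷ inc , last<z

increasing-≡ : ∀ {l m} → Increasing l → Increasing m →
               (∀ {v} → v ∈ l → v ∈ m) → (∀ {v} → v ∈ m → v ∈ l) → l ≡ m
increasing-≡ {[]}    {[]}    _  _  _   _   = refl
increasing-≡ {[]}    {b ∷ m} _  _  _   m⊆l with () ← m⊆l (here refl)
increasing-≡ {a ∷ l} {[]}    _  _  l⊆m _   with () ← l⊆m (here refl)
increasing-≡ {a ∷ l} {b ∷ m} al bm l⊆m m⊆l
  with refl ← ≤-antisym (increasing-head≤ bm (l⊆m (here refl))) (increasing-head≤ al (m⊆l (here refl)))
  = cong (a ∷_) (increasing-≡ (Linked.tail al) (Linked.tail bm)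
                  (λ v∈l → ∈-tail al v∈l (l⊆m (there v∈l))) (λ v∈m → ∈-tail bm v∈m (m⊆l (there v∈m))))
  where
  ∈-tail : ∀ {k v} {ks ws : List ℕ} → Increasing (k ∷ ks) → v ∈ ks → v ∈ k ∷ ws → v ∈ ws
  ∈-tail inc v∈ks (here refl) = contradiction (increasing-head< inc v∈ks) (<-irrefl refl)
  ∈-tail _   _    (there v∈ws) = v∈ws

increasing-minimum : ∀ {l v} → Increasing l → v ∈ l → (∀ {w} → w ∈ l → v ≤ w) → ∃ λ l′ → l ≡ v ∷ l′
increasing-minimum {a ∷ l} _   (here refl)  _   = l , refl
increasing-minimum {a ∷ l} inc (there v∈l) min = contradiction (min (here refl)) (<⇒≱ (increasing-head< inc v∈l))

-- Ascents and the increasing prefix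

ascents-++ : ∀ {a l} m → Increasing (a ∷ l) → ascents ((a ∷ l) ++ m) ≡ length l + ascents (lastOf a l ∷ m)
ascents-++ m [-] = refl
ascents-++ m (a<b ∷ inc) rewrite <ᵇ-true a<b = cong suc (ascents-++ m inc)

ascents-descent : ∀ {a b} l → b ≤ a → ascents (a ∷ b ∷ l) ≡ ascents (b ∷ l)
ascents-descent l b≤a rewrite <ᵇ-false b≤a = refl

ascents-≤ : ∀ a l → ascents (a ∷ l) ≤ length l
ascents-≤ a []      = z≤n
ascents-≤ a (b ∷ l) with a <ᵇ b
... | true  = s≤s (ascents-≤ b l)
... | false = m≤n⇒m≤1+n (ascents-≤ b l)

increasing⇒ascents≡length : ∀ {a l} → Increasing (a ∷ l) → ascents (a ∷ l) ≡ length l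
increasing⇒ascents≡length {l = l} inc = trans (cong ascents (sym (++-identityʳ (_ ∷ l)))) (trans (ascents-++ [] inc) (+-identityʳ _))

ascents≡length⇒increasing : ∀ a l → ascents (a ∷ l) ≡ length l → Increasing (a ∷ l)
ascents≡length⇒increasing a []      _ = [-]
ascents≡length⇒increasing a (b ∷ l) eq with a <ᵇ b | <ᵇ-reflects-< a b
... | true  | ofʸ a<b = a<b ∷ ascents≡length⇒increasing b l (suc-injective eq)
... | false | _       = contradiction (subst (_≤ length l) eq (ascents-≤ b l)) 1+n≰n

BreaksAfter : ℕ → List ℕ → Set
BreaksAfter ℓ []      = ⊤
BreaksAfter ℓ (c ∷ _) = c ≤ ℓ

breaksAfter-head : ∀ {ℓ c C} → Increasing C → c ∈ C → c ≤ ℓ → BreaksAfter ℓ C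
breaksAfter-head {C = _ ∷ _} incC c∈C c≤ℓ = ≤-trans (increasing-head≤ incC c∈C) c≤ℓ

breaksAfter-all : ∀ {ℓ C} → All (_≤ ℓ) C → BreaksAfter ℓ C
breaksAfter-all []          = tt
breaksAfter-all (c≤ℓ ∷ _) = c≤ℓ

IsIncreasingSplit : ℕ → List ℕ → List ℕ → Set
IsIncreasingSplit a A C = Increasing (a ∷ A) × BreaksAfter (lastOf a A) C

increasingPrefix : ℕ → List ℕ → List ℕ × List ℕ
increasingPrefix a []      = [] , []
increasingPrefix a (b ∷ l) = if a <ᵇ b then map₁ (b ∷_) (increasingPrefix b l) else ([] , b ∷ l)

increasingPrefix-correct : ∀ a l → let (A , C) = increasingPrefix a l in l ≡ A ++ C × IsIncreasingSplit a A C
increasingPrefix-correct a []      = refl , [-] , tt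
increasingPrefix-correct a (b ∷ l) with a <ᵇ b | <ᵇ-reflects-< a b
... | true  | ofʸ a<b = let (l≡ , inc , breaks) = increasingPrefix-correct b l in cong (b ∷_) l≡ , a<b ∷ inc , breaks
... | false | ofⁿ a≮b = refl , [-] , ≮⇒≥ a≮b

increasingPrefix-unique : ∀ {a A C} → IsIncreasingSplit a A C → increasingPrefix a (A ++ C) ≡ (A , C)
increasingPrefix-unique {A = []}    {[]}    _              = refl
increasingPrefix-unique {A = []}    {c ∷ C} ([-] , c≤a)     rewrite <ᵇ-false c≤a = refl
increasingPrefix-unique {A = b ∷ A}         (a<b ∷ inc , breaks)
  rewrite <ᵇ-true a<b | increasingPrefix-unique {A = A} (inc , breaks) = refl

-- Descending runs and Pop

IsRun : List ℕ → Set
IsRun r = Linked _>_ r × r ≢ []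

NoDescentBetween : List ℕ → List ℕ → Set
NoDescentBetween r s = ∀ {a b} → last r ≡ just a → head s ≡ just b → a ≤ b

noDescentBetween : ∀ {r s u w} → last r ≡ just u → head s ≡ just w → u ≤ w → NoDescentBetween r s
noDescentBetween lr hs u≤w lr′ hs′ with refl ← trans (sym lr) lr′ | refl ← trans (sym hs) hs′ = u≤w

RunDecomposition : List (List ℕ) → Set
RunDecomposition rs = All IsRun rs × Linked NoDescentBetween rs

private
  meets-tail : ∀ {a b r rs} → Linked NoDescentBetween ((a ∷ b ∷ r) ∷ rs) → Linked NoDescentBetween ((b ∷ r) ∷ rs)
  meets-tail [-]          = [-]
  meets-tail (m ∷ meets) = m ∷ meets

mutual
  descRuns-concat : ∀ {rs} → RunDecomposition rs → descRuns (concat rs) ≡ rs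
  descRuns-concat {[]}           _                     = refl
  descRuns-concat {[] ∷ _}       ((_ , []≢[]) ∷ _ , _) = contradiction refl []≢[]
  descRuns-concat {(a ∷ r) ∷ rs} d                     = descRuns-run a r rs d

  descRuns-run : ∀ a r rs → RunDecomposition ((a ∷ r) ∷ rs) → descRuns (a ∷ r ++ concat rs) ≡ (a ∷ r) ∷ rs
  descRuns-run a []      []             _ = refl
  descRuns-run a []      ([] ∷ _)       (_ ∷ (_ , []≢[]) ∷ _ , _) = contradiction refl []≢[]
  descRuns-run a []      ((b ∷ s) ∷ rs) (_ ∷ runs , a≤b ∷ meets)
    rewrite descRuns-run b s rs (runs , meets) | <ᵇ-false {b} {a} (a≤b refl refl) = refl
  descRuns-run a (b ∷ r) rs (((b<a ∷ run) , _) ∷ runs , meets)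
    rewrite descRuns-run b r rs ((run , λ ()) ∷ runs , meets-tail meets) | <ᵇ-true b<a = refl

descRuns-correct : ∀ x → RunDecomposition (descRuns x) × concat (descRuns x) ≡ x
descRuns-correct []      = ([] , []) , refl
descRuns-correct (a ∷ x) with descRuns x | descRuns-correct x
... | []           | _ , x≡ = (([-] , λ ()) ∷ [] , [-]) , cong (a ∷_) x≡
... | [] ∷ _       | ((_ , []≢[]) ∷ _ , _) , _ = contradiction refl []≢[]
... | (b ∷ r) ∷ rs | ((run , _) ∷ runs , meets) , x≡ with b <ᵇ a | <ᵇ-reflects-< b a
...   | true  | ofʸ b<a = ((b<a ∷ run , λ ()) ∷ runs , extend meets) , cong (a ∷_) x≡
  where
  extend : Linked NoDescentBetween ((b ∷ r) ∷ rs) → Linked NoDescentBetween ((a ∷ b ∷ r) ∷ rs)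
  extend [-]          = [-]
  extend (m ∷ meets) = m ∷ meets
...   | false | ofⁿ b≮a = (([-] , λ ()) ∷ (run , λ ()) ∷ runs , (λ { refl refl → ≮⇒≥ b≮a }) ∷ meets) , cong (a ∷_) x≡

pop-concat : ∀ {rs} → RunDecomposition rs → pop (concat rs) ≡ concatMap reverse rs
pop-concat d = cong (concatMap reverse) (descRuns-concat d)

pop-↭ : ∀ x → pop x ↭ x
pop-↭ x = ↭-trans (concatMap-reverse-↭ (descRuns x)) (↭-reflexive (proj₂ (descRuns-correct x)))
  where
  concatMap-reverse-↭ : ∀ rs → concatMap reverse rs ↭ concat rs
  concatMap-reverse-↭ []       = ↭-refl
  concatMap-reverse-↭ (r ∷ rs) = ++⁺ (↭-reverse r) (concatMap-reverse-↭ rs)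

-- Mirror images

module Mirror (K : ℕ) where

  complement : ℕ → ℕ
  complement v = K ∸ v

  mirror : List ℕ → List ℕ
  mirror l = reverse (map complement l)

  complement-involutive : ∀ {v} → v ≤ K → complement (complement v) ≡ v
  complement-involutive = m∸[m∸n]≡n

  zipWith-complement : ∀ {l} → All (_≤ K) l → zipWith _+_ l (map complement l) ≡ replicate (length l) K
  zipWith-complement []          = refl
  zipWith-complement (v≤K ∷ l≤K) = cong₂ _∷_ (m+[n∸m]≡n v≤K) (zipWith-complement l≤K)

  zipWith≡replicate⇒complement : ∀ {l l′ m} → length l ≡ length l′ → zipWith _+_ l l′ ≡ replicate m K → l′ ≡ map complement l
  zipWith≡replicate⇒complement {[]}    {[]}              _   _  = refl
  zipWith≡replicate⇒complement {u ∷ l} {w ∷ l′} {suc m} len eq =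
    cong₂ _∷_ (trans (sym (m+n∸m≡n u w)) (cong (_∸ u) (∷-injectiveˡ eq)))
              (zipWith≡replicate⇒complement (suc-injective len) (∷-injectiveʳ eq))

  mirror-involutive : ∀ {l} → All (_≤ K) l → mirror (mirror l) ≡ l
  mirror-involutive {l} l≤K = begin
    reverse (map complement (reverse (map complement l)))
      ≡⟨ cong reverse (reverse-map complement (map complement l)) ⟩
    reverse (reverse (map complement (map complement l)))
      ≡⟨ reverse-involutive _ ⟩
    map complement (map complement l)
      ≡⟨ map-∘ l ⟨
    map (complement ∘ complement) l
      ≡⟨ map-id-local (All.map complement-involutive l≤K) ⟩
    l                                                     ∎
    where open ≡-Reasoning

  mirror-++ : ∀ l m → mirror (l ++ m) ≡ mirror m ++ mirror l
  mirror-++ l m = trans (cong reverse (map-++ complement l m)) (reverse-++ (map complement l) (map complement m))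

  length-mirror : ∀ l → length (mirror l) ≡ length l
  length-mirror l = trans (length-reverse (map complement l)) (length-map complement l)

  reverse-mirror : ∀ l → reverse (mirror l) ≡ map complement l
  reverse-mirror l = reverse-involutive (map complement l)

  mirror-reverse : ∀ l → mirror (reverse l) ≡ map complement l
  mirror-reverse l = trans (cong reverse (reverse-map complement l)) (reverse-involutive (map complement l))

  mirror≡[] : ∀ {l} → mirror l ≡ [] → l ≡ []
  mirror≡[] {[]}    _  = refl
  mirror≡[] {a ∷ l} eq with () ← trans (sym (length-mirror (a ∷ l))) (cong length eq)

  ∈-mirror⁺ : ∀ {v l} → v ∈ l → complement v ∈ mirror l
  ∈-mirror⁺ {l = l} v∈l = ∈-resp-↭ (↭-sym (↭-reverse (map complement l))) (∈-map⁺ complement v∈l)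

  ∈-mirror⁻ : ∀ {v} l → v ∈ mirror l → ∃ λ u → u ∈ l × v ≡ complement u
  ∈-mirror⁻ l v∈ = ∈-map⁻ complement (∈-resp-↭ (↭-reverse (map complement l)) v∈)

  mirror-↭ : ∀ {l m} → l ↭ m → mirror l ↭ mirror m
  mirror-↭ {l} {m} l↭m =
    ↭-trans (↭-reverse (map complement l)) (↭-trans (↭.map⁺ complement l↭m) (↭-sym (↭-reverse (map complement m))))

  map-complement-increasing : ∀ {l} → All (_≤ K) l → Increasing l → Linked _>_ (map complement l)
  map-complement-increasing []           []         = []
  map-complement-increasing (_ ∷ [])     [-]        = [-]
  map-complement-increasing (_ ∷ w≤K ∷ ws) (u<w ∷ inc) = ∸-monoʳ-< u<w w≤K ∷ map-complement-increasing (w≤K ∷ ws) inc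

  map-complement-decreasing : ∀ {l} → All (_≤ K) l → Linked _>_ l → Increasing (map complement l)
  map-complement-decreasing []           []         = []
  map-complement-decreasing (_ ∷ [])     [-]        = [-]
  map-complement-decreasing (u≤K ∷ ws) (w<u ∷ dec) = ∸-monoʳ-< w<u u≤K ∷ map-complement-decreasing ws dec

  mirror-increasing : ∀ {l} → All (_≤ K) l → Increasing l → Increasing (mirror l)
  mirror-increasing l≤K inc = Linked-reverse (map-complement-increasing l≤K inc)

  mirror-decreasing : ∀ {l} → All (_≤ K) l → Linked _>_ l → Linked _>_ (mirror l)
  mirror-decreasing l≤K dec = Linked-reverse (map-complement-decreasing l≤K dec)

  head-mirror : ∀ l → head (mirror l) ≡ Maybe.map complement (last l)
  head-mirror l = trans (head-reverse (map complement l)) (last-map complement l)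

  last-mirror : ∀ l → last (mirror l) ≡ Maybe.map complement (head l)
  last-mirror l = trans (last-reverse (map complement l)) (head-map l)

  mirror-concat : ∀ rs → mirror (concat rs) ≡ concat (reverse (map mirror rs))
  mirror-concat []       = refl
  mirror-concat (r ∷ rs) = begin
    mirror (r ++ concat rs)
      ≡⟨ mirror-++ r (concat rs) ⟩
    mirror (concat rs) ++ mirror r
      ≡⟨ cong₂ _++_ (mirror-concat rs) (sym (++-identityʳ (mirror r))) ⟩
    concat (reverse (map mirror rs)) ++ concat (mirror r ∷ [])
      ≡⟨ concat-++ (reverse (map mirror rs)) _ ⟩
    concat (reverse (map mirror rs) ∷ʳ mirror r)
      ≡⟨ cong concat (unfold-reverse (mirror r) (map mirror rs)) ⟨
    concat (reverse (map mirror (r ∷ rs)))                     ∎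
    where open ≡-Reasoning

  mirror-isRun : ∀ {r} → All (_≤ K) r → IsRun r → IsRun (mirror r)
  mirror-isRun r≤K (dec , r≢[]) = mirror-decreasing r≤K dec , r≢[] ∘ mirror≡[]

  mirror-noDescentBetween : ∀ {r s} → NoDescentBetween r s → NoDescentBetween (mirror s) (mirror r)
  mirror-noDescentBetween {r} {s} r⋯s la hb
    with head s | last r | trans (sym (last-mirror s)) la | trans (sym (head-mirror r)) hb
  ... | just u | just w | refl | refl = ∸-monoʳ-≤ K (r⋯s refl refl)

  mirror-runDecomposition : ∀ {rs} → All (All (_≤ K)) rs → RunDecomposition rs →
                            RunDecomposition (reverse (map mirror rs))
  mirror-runDecomposition {rs} rs≤K (runs , meets) =
      All-resp-↭ (↭-sym (↭-reverse (map mirror rs))) (All.map⁺ (All.zipWith (λ (r≤K , run) → mirror-isRun r≤K run) (rs≤K , runs)))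
    , Linked-reverse (Linked.map⁺ {R = flip NoDescentBetween} {f = mirror} (Linked.map (λ {r} {s} → mirror-noDescentBetween {r} {s}) meets))

  mirror-sandwich : ∀ l m → All (_≤ K) l → mirror m ≡ m → mirror (l ++ m ++ mirror l) ≡ l ++ m ++ mirror l
  mirror-sandwich l m l≤K mm≡m = begin
    mirror (l ++ m ++ mirror l)
      ≡⟨ mirror-++ l (m ++ mirror l) ⟩
    mirror (m ++ mirror l) ++ mirror l
      ≡⟨ cong (_++ mirror l) (mirror-++ m (mirror l)) ⟩
    (mirror (mirror l) ++ mirror m) ++ mirror l
      ≡⟨ cong₂ (λ u w → (u ++ w) ++ mirror l) (mirror-involutive l≤K) mm≡m ⟩
    (l ++ m) ++ mirror l
      ≡⟨ ++-assoc l m (mirror l) ⟩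
    l ++ m ++ mirror l                   ∎
    where open ≡-Reasoning

  pop-mirror : ∀ y → All (_≤ K) y → pop (mirror y) ≡ mirror (pop y)
  pop-mirror y y≤K = begin
    pop (mirror y)                                     ≡⟨ cong (pop ∘ mirror) (sym y≡) ⟩
    pop (mirror (concat rs))                           ≡⟨ cong pop (mirror-concat rs) ⟩
    pop (concat (reverse (map mirror rs)))             ≡⟨ pop-concat (mirror-runDecomposition rs≤K dec) ⟩
    concat (map reverse (reverse (map mirror rs)))     ≡⟨ cong concat (reverse-map reverse (map mirror rs)) ⟩
    concat (reverse (map reverse (map mirror rs)))     ≡⟨ cong (concat ∘ reverse) map-reverse-mirror ⟩
    concat (reverse (map mirror (map reverse rs)))     ≡⟨ mirror-concat (map reverse rs) ⟨
    mirror (pop y)                                     ∎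
    where
    open ≡-Reasoning
    rs : List (List ℕ)
    rs = descRuns y
    dec : RunDecomposition rs
    dec = proj₁ (descRuns-correct y)
    y≡ : concat rs ≡ y
    y≡ = proj₂ (descRuns-correct y)
    rs≤K : All (All (_≤ K)) rs
    rs≤K = All.concat⁻ (subst (All (_≤ K)) (sym y≡) y≤K)
    map-reverse-mirror : map reverse (map mirror rs) ≡ map mirror (map reverse rs)
    map-reverse-mirror = trans (sym (map-∘ rs))
      (trans (map-cong (λ r → trans (reverse-mirror r) (sym (mirror-reverse r))) rs) (map-∘ rs))

-- Counting by an explicit enumeration

sequences : {A : Set} → List (List A) → List (List A)
sequences []         = [] ∷ []
sequences (xs ∷ xss) = cartesianProductWith _∷_ xs (sequences xss)

sequences-unique : ∀ {A : Set} {xss : List (List A)} → All Unique xss → Unique (sequences xss)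
sequences-unique []       = [] ∷ []
sequences-unique (u ∷ us) = Unique.cartesianProductWith⁺ _∷_ ∷-injective u (sequences-unique us)

length-cartesianProductWith : ∀ {A B C : Set} (f : A → B → C) xs ys →
                              length (cartesianProductWith f xs ys) ≡ length xs * length ys
length-cartesianProductWith f []       ys = refl
length-cartesianProductWith f (x ∷ xs) ys = begin
  length (map (f x) ys ++ cartesianProductWith f xs ys)
    ≡⟨ length-++ (map (f x) ys) ⟩
  length (map (f x) ys) + length (cartesianProductWith f xs ys)
    ≡⟨ cong₂ _+_ (length-map (f x) ys) (length-cartesianProductWith f xs ys) ⟩
  length ys + length xs * length ys                           ∎
  where open ≡-Reasoning

length-sequences : ∀ {A : Set} (xss : List (List A)) → length (sequences xss) ≡ product (map length xss)
length-sequences []         = refl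
length-sequences (xs ∷ xss) =
  trans (length-cartesianProductWith _∷_ xs (sequences xss)) (cong (length xs *_) (length-sequences xss))

nthOr : {A : Set} → A → List A → ℕ → A
nthOr d []       _       = d
nthOr d (x ∷ xs) zero    = x
nthOr d (x ∷ xs) (suc k) = nthOr d xs k

nthOr-applyUpTo : ∀ {A : Set} {d : A} f {m k} → k < m → nthOr d (applyUpTo f m) k ≡ f k
nthOr-applyUpTo f {suc m} {zero}  _         = refl
nthOr-applyUpTo f {suc m} {suc k} (s≤s k<m) = nthOr-applyUpTo (f ∘ suc) k<m

applyUpTo-cong : ∀ {A : Set} {f g : ℕ → A} m → (∀ {k} → k < m → f k ≡ g k) → applyUpTo f m ≡ applyUpTo g m
applyUpTo-cong zero    _   = refl
applyUpTo-cong (suc m) f≡g = cong₂ _∷_ (f≡g (s≤s z≤n)) (applyUpTo-cong m (f≡g ∘ s≤s))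

∈-sequences-applyUpTo⁺ : ∀ {A : Set} {f : ℕ → A} {g : ℕ → List A} m →
                         (∀ {k} → k < m → f k ∈ g k) → applyUpTo f m ∈ sequences (applyUpTo g m)
∈-sequences-applyUpTo⁺ zero    _  = here refl
∈-sequences-applyUpTo⁺ (suc m) fg =
  ∈-cartesianProductWith⁺ _∷_ (fg (s≤s z≤n)) (∈-sequences-applyUpTo⁺ m (fg ∘ s≤s))

∈-sequences-applyUpTo⁻ : ∀ {A : Set} {d : A} {g : ℕ → List A} m {t} → t ∈ sequences (applyUpTo g m) →
                         applyUpTo (nthOr d t) m ≡ t × (∀ {k} → k < m → nthOr d t k ∈ g k)
∈-sequences-applyUpTo⁻ zero (here refl) = refl , λ ()
∈-sequences-applyUpTo⁻ {g = g} (suc m) t∈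
  with r , t′ , r∈ , t′∈ , refl ← ∈-cartesianProductWith⁻ _∷_ (g 0) (sequences (applyUpTo (g ∘ suc) m)) t∈
  with t′≡ , t′g ← ∈-sequences-applyUpTo⁻ m t′∈
  = cong (r ∷_) t′≡ , λ { {zero} _ → r∈ ; {suc k} (s≤s k<m) → t′g k<m }

enumeration : ∀ {A B : Set} {P : B → Set} (codes : List A) (encode : A → B) (decode : B → A) →
  Unique codes →
  (∀ {t} → t ∈ codes → P (encode t)) →
  (∀ {t} → t ∈ codes → decode (encode t) ≡ t) →
  (∀ {x} → P x → decode x ∈ codes) →
  (∀ {x} → P x → encode (decode x) ≡ x) →
  Unique (map encode codes) × (∀ x → x ∈ map encode codes ⇔ P x)
enumeration {P = P} codes encode decode codes! sound retract decode∈ section =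
  Unique.map⁻ (subst Unique (sym decode∘encode) codes!) , λ x → mk⇔ (to x) (from x)
  where
  decode∘encode : map decode (map encode codes) ≡ codes
  decode∘encode = trans (sym (map-∘ codes)) (map-id-local (All.tabulate retract))
  to : ∀ x → x ∈ map encode codes → P x
  to x x∈ with t , t∈ , refl ← ∈-map⁻ encode x∈ = sound t∈
  from : ∀ x → P x → x ∈ map encode codes
  from x px = subst (_∈ map encode codes) (section px) (∈-map⁺ encode (decode∈ px))

∈-oneTo⁺ : ∀ {v m} → 1 ≤ v → v ≤ m → v ∈ oneTo m
∈-oneTo⁺ {suc k} _ (s≤s k<m) = ∈-map⁺ suc (∈-upTo⁺ (s≤s k<m))

∈-oneTo⁻ : ∀ {v m} → v ∈ oneTo m → 1 ≤ v × v ≤ m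
∈-oneTo⁻ v∈ with k , k∈ , refl ← ∈-map⁻ suc v∈ = s≤s z≤n , ∈-upTo⁻ k∈

oneTo-increasing : ∀ m → Increasing (oneTo m)
oneTo-increasing m = subst Increasing (sym (map-upTo suc m)) (Linked.applyUpTo⁺₂ suc m (λ _ → ≤-refl))

length-oneTo : ∀ m → length (oneTo m) ≡ m
length-oneTo m = trans (length-map suc (upTo m)) (length-upTo m)

-- Roles of the letters 1, …, n

-- The role of a letter v ≤ n in a first half A ++ C: v ∈ A, v ∈ C, or neither (then v̄ ∈ A).
data Role : Set where
  inA inC outside : Role

_≟ᴿ_ : DecidableEquality Role
inA     ≟ᴿ inA     = yes refl
inA     ≟ᴿ inC     = no λ ()
inA     ≟ᴿ outside = no λ ()
inC     ≟ᴿ inA     = no λ ()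
inC     ≟ᴿ inC     = yes refl
inC     ≟ᴿ outside = no λ ()
outside ≟ᴿ inA     = no λ ()
outside ≟ᴿ inC     = no λ ()
outside ≟ᴿ outside = yes refl

allowedRoles : ℕ → ℕ → List Role
allowedRoles i v with <-cmp v i
... | tri< _ _ _ = outside ∷ inC ∷ []
... | tri≈ _ _ _ = inA ∷ []
... | tri> _ _ _ = inA ∷ inC ∷ outside ∷ []

allowedRoles-unique : ∀ i v → Unique (allowedRoles i v)
allowedRoles-unique i v with <-cmp v i
... | tri< _ _ _ = ((λ ()) ∷ []) ∷ [] ∷ []
... | tri≈ _ _ _ = [] ∷ []
... | tri> _ _ _ = ((λ ()) ∷ (λ ()) ∷ []) ∷ ((λ ()) ∷ []) ∷ [] ∷ []

roleAssignments : ℕ → ℕ → List (List Role)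
roleAssignments n i = sequences (applyUpTo (allowedRoles i ∘ suc) n)

roleAssignments-unique : ∀ n i → Unique (roleAssignments n i)
roleAssignments-unique n i = sequences-unique (All.applyUpTo⁺₂ (allowedRoles i ∘ suc) n (allowedRoles-unique i ∘ suc))

length-allowedRoles-< : ∀ {i v} → v < i → length (allowedRoles i v) ≡ 2
length-allowedRoles-< {i} {v} v<i with <-cmp v i
... | tri< _ _ _   = refl
... | tri≈ v≮i _ _ = contradiction v<i v≮i
... | tri> v≮i _ _ = contradiction v<i v≮i

length-allowedRoles-≡ : ∀ i → length (allowedRoles i i) ≡ 1
length-allowedRoles-≡ i with <-cmp i i
... | tri< _ i≢i _ = contradiction refl i≢i
... | tri≈ _ _ _   = refl
... | tri> _ i≢i _ = contradiction refl i≢i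

length-allowedRoles-> : ∀ {i v} → i < v → length (allowedRoles i v) ≡ 3
length-allowedRoles-> {i} {v} i<v with <-cmp v i
... | tri< _ _ v≯i = contradiction i<v v≯i
... | tri≈ _ _ v≯i = contradiction i<v v≯i
... | tri> _ _ _   = refl

length-roleAssignments : ∀ n i → 1 ≤ i → i ≤ n → length (roleAssignments n i) ≡ 2 ^ (i ∸ 1) * 3 ^ (n ∸ i)
length-roleAssignments n (suc j) _ i≤n = begin
  length (sequences (applyUpTo (allowedRoles i ∘ suc) n))
    ≡⟨ length-sequences (applyUpTo (allowedRoles i ∘ suc) n) ⟩
  product (map length (applyUpTo (allowedRoles i ∘ suc) n))
    ≡⟨ cong product (map-applyUpTo _ length n) ⟩
  choices n
    ≡⟨ cong choices (m+[n∸m]≡n i≤n) ⟨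
  choices (suc (j + (n ∸ i)))
    ≡⟨ choices-from (n ∸ i) ⟩
  2 ^ j * 3 ^ (n ∸ i)                                       ∎
  where
  open ≡-Reasoning
  i : ℕ
  i = suc j
  choices : ℕ → ℕ
  choices m = product (applyUpTo (length ∘ allowedRoles i ∘ suc) m)

  choices-suc : ∀ m → choices (suc m) ≡ choices m * length (allowedRoles i (suc m))
  choices-suc m = begin
    product (applyUpTo f (suc m))          ≡⟨ cong product (applyUpTo-∷ʳ f m) ⟨
    product (applyUpTo f m ∷ʳ f m)         ≡⟨ product-++ (applyUpTo f m) (f m ∷ []) ⟩
    choices m * (f m * 1)                  ≡⟨ cong (choices m *_) (*-identityʳ (f m)) ⟩
    choices m * f m                        ∎
    where f = length ∘ allowedRoles i ∘ suc

  choices-below : ∀ m → m ≤ j → choices m ≡ 2 ^ m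
  choices-below zero    _    = refl
  choices-below (suc m) m<j = begin
    choices (suc m)
      ≡⟨ choices-suc m ⟩
    choices m * length (allowedRoles i (suc m))
      ≡⟨ cong₂ _*_ (choices-below m (<⇒≤ m<j)) (length-allowedRoles-< (s≤s m<j)) ⟩
    2 ^ m * 2
      ≡⟨ *-comm (2 ^ m) 2 ⟩
    2 ^ suc m                                      ∎

  choices-from : ∀ k → choices (suc (j + k)) ≡ 2 ^ j * 3 ^ k
  choices-from zero rewrite +-identityʳ j = begin
    choices (suc j)
      ≡⟨ choices-suc j ⟩
    choices j * length (allowedRoles i i)
      ≡⟨ cong₂ _*_ (choices-below j ≤-refl) (length-allowedRoles-≡ i) ⟩
    2 ^ j * 1                                  ∎
  choices-from (suc k) rewrite +-suc j k = begin
    choices (suc (suc (j + k)))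
      ≡⟨ choices-suc (suc (j + k)) ⟩
    choices (suc (j + k)) * length (allowedRoles i (suc (suc (j + k))))
      ≡⟨ cong₂ _*_ (choices-from k) (length-allowedRoles-> (s≤s (s≤s (m≤m+n j k)))) ⟩
    2 ^ j * 3 ^ k * 3
      ≡⟨ *-assoc (2 ^ j) (3 ^ k) 3 ⟩
    2 ^ j * (3 ^ k * 3)
      ≡⟨ cong (2 ^ j *_) (*-comm (3 ^ k) 3) ⟩
    2 ^ j * 3 ^ suc k                          ∎

private
  shift₂ : ∀ {X : Set} (x : X) a c o → a ++ c ++ x ∷ o ↭ x ∷ a ++ c ++ o
  shift₂ x a c o =
    ↭-trans (↭-sym (↭.++-assoc a c (x ∷ o))) (↭-trans (shift x (a ++ c) o) (↭-prep x (↭.++-assoc a c o)))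

withRole : ∀ {X : Set} → (X → Role) → Role → List X → List X
withRole ρ r = filter (λ x → ρ x ≟ᴿ r)

withRole-↭ : ∀ {X : Set} (ρ : X → Role) xs → withRole ρ inA xs ++ withRole ρ inC xs ++ withRole ρ outside xs ↭ xs
withRole-↭ ρ []       = ↭-refl
withRole-↭ ρ (x ∷ xs) with ρ x | withRole-↭ ρ xs
... | inA     | p = ↭-prep x p
... | inC     | p = ↭-trans (shift x (withRole ρ inA xs) _) (↭-prep x p)
... | outside | p = ↭-trans (shift₂ x (withRole ρ inA xs) (withRole ρ inC xs) _) (↭-prep x p)

roleIn : List ℕ → List ℕ → ℕ → Role
roleIn A C v with v ∈? A | v ∈? C
... | yes _ | _     = inA
... | no _  | yes _ = inC
... | no _  | no _  = outside

module _ {A C : List ℕ} {v : ℕ} where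

  roleIn-inA : v ∈ A → roleIn A C v ≡ inA
  roleIn-inA v∈A with v ∈? A
  ... | yes _   = refl
  ... | no  v∉A = contradiction v∈A v∉A

  roleIn-inC : v ∉ A → v ∈ C → roleIn A C v ≡ inC
  roleIn-inC v∉A v∈C with v ∈? A | v ∈? C
  ... | yes v∈A | _       = contradiction v∈A v∉A
  ... | no _    | yes _   = refl
  ... | no _    | no  v∉C = contradiction v∈C v∉C

  roleIn-outside : v ∉ A → v ∉ C → roleIn A C v ≡ outside
  roleIn-outside v∉A v∉C with v ∈? A | v ∈? C
  ... | yes v∈A | _       = contradiction v∈A v∉A
  ... | no _    | yes v∈C = contradiction v∈C v∉C
  ... | no _    | no _    = refl

  roleIn-∉ : v ∉ A → roleIn A C v ≡ inC ⊎ roleIn A C v ≡ outside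
  roleIn-∉ v∉A with v ∈? A | v ∈? C
  ... | yes v∈A | _     = contradiction v∈A v∉A
  ... | no _    | yes _ = inj₁ refl
  ... | no _    | no _  = inj₂ refl

  roleIn≡inA : roleIn A C v ≡ inA → v ∈ A
  roleIn≡inA eq with v ∈? A | v ∈? C
  roleIn≡inA eq    | yes v∈A | _ = v∈A
  roleIn≡inA ()    | no _    | yes _
  roleIn≡inA ()    | no _    | no _

  roleIn≡inC : roleIn A C v ≡ inC → v ∈ C
  roleIn≡inC eq with v ∈? A | v ∈? C
  roleIn≡inC ()    | yes _ | _
  roleIn≡inC eq    | no _  | yes v∈C = v∈C
  roleIn≡inC ()    | no _  | no _

  roleIn≡outside : roleIn A C v ≡ outside → v ∉ A × v ∉ C
  roleIn≡outside eq with v ∈? A | v ∈? C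
  roleIn≡outside ()   | yes _   | _
  roleIn≡outside ()   | no _    | yes _
  roleIn≡outside eq   | no v∉A  | no v∉C = v∉A , v∉C

roleIn-allowed : ∀ {i A C v} → i ∈ A → (∀ {w} → w ∈ A → i ≤ w) → roleIn A C v ∈ allowedRoles i v
roleIn-allowed {i} {A} {C} {v} i∈A i≤A with <-cmp v i
... | tri< v<i _ _ with roleIn-∉ {C = C} (λ v∈A → <⇒≱ v<i (i≤A v∈A))
...   | inj₁ ≡inC     = there (here ≡inC)
...   | inj₂ ≡outside = here ≡outside
roleIn-allowed i∈A _ | tri≈ _ refl _ = here (roleIn-inA i∈A)
roleIn-allowed {A = A} {C} {v} _ _ | tri> _ _ _ with roleIn A C v
... | inA     = here refl
... | inC     = there (here refl)
... | outside = there (there (here refl))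

-- Words of type B

module TypeB (n : ℕ) where

  open Mirror (suc (2 * n)) public

  Letter : ℕ → Set
  Letter v = 1 ≤ v × v ≤ 2 * n

  2*n≡n+n : 2 * n ≡ n + n
  2*n≡n+n = cong (n +_) (+-identityʳ n)

  ≤n⇒n<complement : ∀ {v} → v ≤ n → n < complement v
  ≤n⇒n<complement {v} v≤n = m+n≤o⇒m≤o∸n (suc n) (begin
    suc n + v   ≤⟨ +-monoʳ-≤ (suc n) v≤n ⟩
    suc (n + n) ≡⟨ cong suc 2*n≡n+n ⟨
    suc (2 * n) ∎)
    where open ≤-Reasoning

  n<⇒complement≤n : ∀ {v} → n < v → complement v ≤ n
  n<⇒complement≤n {v} n<v = m≤n+o⇒m∸n≤o (suc (2 * n)) v (begin
    suc (2 * n) ≡⟨ cong suc 2*n≡n+n ⟩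
    suc n + n   ≤⟨ +-monoˡ-≤ n n<v ⟩
    v + n       ∎)
    where open ≤-Reasoning

  <complement⇒≤n : ∀ {v} → v < complement v → v ≤ n
  <complement⇒≤n {v} v<v̄ with v ≤? n
  ... | yes v≤n = v≤n
  ... | no  v≰n = contradiction v<v̄ (<⇒≯ (≤-<-trans (n<⇒complement≤n (≰⇒> v≰n)) (≰⇒> v≰n)))

  complement-letter : ∀ {v} → Letter v → Letter (complement v)
  complement-letter {v} (1≤v , v≤2n) = m+n≤o⇒m≤o∸n 1 (s≤s v≤2n) , m≤n+o⇒m∸n≤o (suc (2 * n)) v (+-monoˡ-≤ (2 * n) 1≤v)

  complement-2n : complement (2 * n) ≡ 1
  complement-2n = m+n∸n≡m 1 (2 * n)

  letter-≤ : ∀ {v} → Letter v → v ≤ suc (2 * n)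
  letter-≤ (_ , v≤2n) = m≤n⇒m≤1+n v≤2n

  oneTo-bounded : ∀ m → m ≤ suc (2 * n) → All (_≤ suc (2 * n)) (oneTo m)
  oneTo-bounded m m≤K = All.tabulate (λ v∈ → ≤-trans (proj₂ (∈-oneTo⁻ v∈)) m≤K)

  n≤2n : n ≤ 2 * n
  n≤2n = m≤m+n n (n + 0)

  ≤n⇒≤K : ∀ {l} → All (_≤ n) l → All (_≤ suc (2 * n)) l
  ≤n⇒≤K = All.map (λ v≤n → ≤-trans v≤n (m≤n⇒m≤1+n n≤2n))

  n<mirror : ∀ {l w} → All (_≤ n) l → w ∈ mirror l → n < w
  n<mirror {l} l≤n w∈ with u , u∈ , refl ← ∈-mirror⁻ l w∈ = ≤n⇒n<complement (All.lookup l≤n u∈)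

  oneTo-double : oneTo n ++ mirror (oneTo n) ≡ oneTo (2 * n)
  oneTo-double = increasing-≡
    (increasing-++ (oneTo-increasing n) (mirror-increasing bounded (oneTo-increasing n))
      (λ u∈ w∈ → ≤-<-trans (proj₂ (∈-oneTo⁻ u∈)) (n<mirror (All.tabulate (proj₂ ∘ ∈-oneTo⁻)) w∈)))
    (oneTo-increasing (2 * n)) sub sup
    where
    bounded : All (_≤ suc (2 * n)) (oneTo n)
    bounded = oneTo-bounded n (m≤n⇒m≤1+n n≤2n)
    sub : ∀ {v} → v ∈ oneTo n ++ mirror (oneTo n) → v ∈ oneTo (2 * n)
    sub v∈ with ∈-++⁻ (oneTo n) v∈
    ... | inj₁ v∈l = let (1≤v , v≤n) = ∈-oneTo⁻ v∈l in ∈-oneTo⁺ 1≤v (≤-trans v≤n n≤2n)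
    ... | inj₂ v∈r with u , u∈ , refl ← ∈-mirror⁻ (oneTo n) v∈r =
      let (1≤u , u≤n) = ∈-oneTo⁻ u∈ in uncurry ∈-oneTo⁺ (complement-letter (1≤u , ≤-trans u≤n n≤2n))
    sup : ∀ {v} → v ∈ oneTo (2 * n) → v ∈ oneTo n ++ mirror (oneTo n)
    sup {v} v∈ with ∈-oneTo⁻ v∈ | v ≤? n
    ... | 1≤v , _    | yes v≤n = ∈-++⁺ˡ (∈-oneTo⁺ 1≤v v≤n)
    ... | 1≤v , v≤2n | no  v≰n =
      ∈-++⁺ʳ (oneTo n) (subst (_∈ mirror (oneTo n)) (complement-involutive (letter-≤ (1≤v , v≤2n)))
        (∈-mirror⁺ (∈-oneTo⁺ (proj₁ (complement-letter (1≤v , v≤2n))) (n<⇒complement≤n (≰⇒> v≰n)))))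

  take-suc-symmetric : ∀ a l → length (a ∷ l) ≡ n →
                       take (suc n) ((a ∷ l) ++ mirror (a ∷ l)) ≡ (a ∷ l) ++ complement (lastOf a l) ∷ []
  take-suc-symmetric a l len = begin
    take (suc n) ((a ∷ l) ++ mirror (a ∷ l))
      ≡⟨ cong (λ k → take k ((a ∷ l) ++ mirror (a ∷ l))) (trans (+-comm 1 n) (cong (_+ 1) (sym len))) ⟩
    take (length (a ∷ l) + 1) ((a ∷ l) ++ mirror (a ∷ l))
      ≡⟨ take-++-length (a ∷ l) (mirror (a ∷ l)) 1 ⟩
    (a ∷ l) ++ take 1 (mirror (a ∷ l))
      ≡⟨ cong ((a ∷ l) ++_) (take-1 (trans (head-mirror (a ∷ l)) (cong (Maybe.map complement) (last-∷ a l)))) ⟩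
    (a ∷ l) ++ complement (lastOf a l) ∷ []                ∎
    where open ≡-Reasoning

  symmetric-halves : ∀ {x} → mirror x ≡ x → length x ≡ 2 * n → x ≡ take n x ++ mirror (take n x)
  symmetric-halves {x} mx≡x len = trans (sym (take++drop≡id n x)) (cong (take n x ++_) (sym (proj₂ halves)))
    where
    length-take-n : length (take n x) ≡ n
    length-take-n = trans (length-take n x) (trans (cong (n ⊓_) len) (m≤n⇒m⊓n≡m n≤2n))
    length-drop-n : length (drop n x) ≡ n
    length-drop-n = trans (length-drop n x) (trans (cong (_∸ n) (trans len 2*n≡n+n)) (m+n∸m≡n n n))
    halves : mirror (drop n x) ≡ take n x × mirror (take n x) ≡ drop n x
    halves = ++-cancel-length (mirror (drop n x)) (take n x)
      (trans (length-mirror (drop n x)) (trans length-drop-n (sym length-take-n)))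
      (begin
        mirror (drop n x) ++ mirror (take n x) ≡⟨ mirror-++ (take n x) (drop n x) ⟨
        mirror (take n x ++ drop n x)          ≡⟨ cong mirror (take++drop≡id n x) ⟩
        mirror x                               ≡⟨ mx≡x ⟩
        x                                      ≡⟨ take++drop≡id n x ⟨
        take n x ++ drop n x                   ∎)
      where open ≡-Reasoning

  B⇒self-mirror : ∀ {y} → B n y → mirror y ≡ y
  B⇒self-mirror {y} (_ , zip≡) = begin
    reverse (map complement y) ≡⟨ cong reverse (zipWith≡replicate⇒complement (sym (length-reverse y)) zip≡) ⟨
    reverse (reverse y)        ≡⟨ reverse-involutive y ⟩
    y                          ∎
    where open ≡-Reasoning

  self-mirror⇒B : ∀ {y} → y ↭ oneTo (2 * n) → mirror y ≡ y → B n y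
  self-mirror⇒B {y} y↭ my≡y = y↭ , (begin
    zipWith _+_ y (reverse y)
      ≡⟨ cong (zipWith _+_ y) (trans (cong reverse (sym my≡y)) (reverse-mirror y)) ⟩
    zipWith _+_ y (map complement y)
      ≡⟨ zipWith-complement y≤K ⟩
    replicate (length y) (suc (2 * n))
      ≡⟨ cong (λ m → replicate m (suc (2 * n))) (trans (↭-length y↭) (length-oneTo (2 * n))) ⟩
    replicate (2 * n) (suc (2 * n))              ∎)
    where
    open ≡-Reasoning
    y≤K : All (_≤ suc (2 * n)) y
    y≤K = All-resp-↭ (↭-sym y↭) (oneTo-bounded (2 * n) (n≤1+n (2 * n)))

  -- Its descending runs are reverse A, reverse (C ++ mirror C) unless C = [], and mirror (reverse A).
  popPreimage : List ℕ → List ℕ → List ℕ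
  popPreimage A C = reverse A ++ reverse (C ++ mirror C) ++ mirror (reverse A)

  popPreimage-self-mirror : ∀ {A C} → All (_≤ suc (2 * n)) A → All (_≤ suc (2 * n)) C →
                            mirror (popPreimage A C) ≡ popPreimage A C
  popPreimage-self-mirror {A} {C} A≤K C≤K =
    mirror-sandwich (reverse A) (reverse M) (All-resp-↭ (↭-sym (↭-reverse A)) A≤K) reverse-M-self-mirror
    where
    M : List ℕ
    M = C ++ mirror C
    reverse-M-self-mirror : mirror (reverse M) ≡ reverse M
    reverse-M-self-mirror = trans (mirror-reverse M) (trans (sym (reverse-mirror M)) (cong reverse (mirror-sandwich C [] C≤K refl)))

  pop-popPreimage : ∀ {a A C} → Increasing (a ∷ A) → All (_≤ suc (2 * n)) (a ∷ A) → a ≤ n → Increasing C → All (_≤ n) C →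
                    pop (popPreimage (a ∷ A) C) ≡ ((a ∷ A) ++ C) ++ mirror ((a ∷ A) ++ C)
  pop-popPreimage {a} {A} {C} incA A≤K a≤n incC C≤n = begin
    pop (popPreimage (a ∷ A) C)
      ≡⟨ cong (λ w → pop (reverse (a ∷ A) ++ reverse (C ++ mirror C) ++ w)) (mirror-reverse (a ∷ A)) ⟩
    pop (R₁ ++ reverse (C ++ mirror C) ++ R₃)
      ≡⟨ pop-runs C incC C≤n ⟩
    (a ∷ A) ++ C ++ mirror C ++ mirror (a ∷ A)
      ≡⟨ cong ((a ∷ A) ++_) (cong (C ++_) (mirror-++ (a ∷ A) C)) ⟨
    (a ∷ A) ++ C ++ mirror ((a ∷ A) ++ C)
      ≡⟨ ++-assoc (a ∷ A) C _ ⟨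
    ((a ∷ A) ++ C) ++ mirror ((a ∷ A) ++ C) ∎
    where
    open ≡-Reasoning
    R₁ R₃ : List ℕ
    R₁ = reverse (a ∷ A)
    R₃ = map complement (a ∷ A)
    ≤complement-a : ∀ {v} → v ≤ n → v ≤ complement a
    ≤complement-a v≤n = <⇒≤ (≤-<-trans v≤n (≤n⇒n<complement a≤n))
    R₁-run : IsRun R₁
    R₁-run = Linked-reverse incA , reverse-∷≢[] a A
    R₃-run : IsRun R₃
    R₃-run = map-complement-increasing A≤K incA , λ ()
    last-R₁ : last R₁ ≡ just a
    last-R₁ = last-reverse (a ∷ A)
    pop-runs : ∀ C → Increasing C → All (_≤ n) C → pop (R₁ ++ reverse (C ++ mirror C) ++ R₃) ≡ (a ∷ A) ++ C ++ mirror C ++ mirror (a ∷ A)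
    pop-runs [] _ _ = begin
      pop (R₁ ++ R₃)
        ≡⟨ cong (λ w → pop (R₁ ++ w)) (++-identityʳ R₃) ⟨
      pop (concat (R₁ ∷ R₃ ∷ []))
        ≡⟨ pop-concat (R₁-run ∷ R₃-run ∷ [] , noDescentBetween {R₁} {R₃} last-R₁ refl (≤complement-a a≤n) ∷ [-]) ⟩
      reverse R₁ ++ reverse R₃ ++ []
        ≡⟨ cong₂ _++_ (reverse-involutive (a ∷ A)) (++-identityʳ (reverse R₃)) ⟩
      (a ∷ A) ++ mirror (a ∷ A)             ∎
    pop-runs (c ∷ C) incC (c≤n ∷ C≤n) = begin
      pop (R₁ ++ R₂ ++ R₃)
        ≡⟨ cong (λ w → pop (R₁ ++ R₂ ++ w)) (++-identityʳ R₃) ⟨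
      pop (concat (R₁ ∷ R₂ ∷ R₃ ∷ []))
        ≡⟨ pop-concat (R₁-run ∷ R₂-run ∷ R₃-run ∷ [] , meet₁₂ ∷ meet₂₃ ∷ [-]) ⟩
      reverse R₁ ++ reverse R₂ ++ reverse R₃ ++ []
        ≡⟨ cong₂ _++_ (reverse-involutive (a ∷ A)) (cong₂ _++_ (reverse-involutive M) (++-identityʳ (reverse R₃))) ⟩
      (a ∷ A) ++ M ++ mirror (a ∷ A)
        ≡⟨ cong ((a ∷ A) ++_) (++-assoc (c ∷ C) (mirror (c ∷ C)) _) ⟩
      (a ∷ A) ++ (c ∷ C) ++ mirror (c ∷ C) ++ mirror (a ∷ A) ∎
      where
      M R₂ : List ℕ
      M = (c ∷ C) ++ mirror (c ∷ C)
      R₂ = reverse M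
      C≤K : All (_≤ suc (2 * n)) (c ∷ C)
      C≤K = ≤n⇒≤K (c≤n ∷ C≤n)
      R₂-run : IsRun R₂
      R₂-run = Linked-reverse (increasing-++ incC (mirror-increasing C≤K incC)
                 (λ u∈ w∈ → ≤-<-trans (All.lookup (c≤n ∷ C≤n) u∈) (n<mirror (c≤n ∷ C≤n) w∈))) , reverse-∷≢[] c (C ++ mirror (c ∷ C))
      meet₁₂ : NoDescentBetween R₁ R₂
      meet₁₂ = noDescentBetween {R₁} {R₂} last-R₁
        (trans (head-reverse M) (trans (last-++ (c ∷ C) (λ eq → contradiction (mirror≡[] {c ∷ C} eq) λ ())) (last-mirror (c ∷ C))))
        (<⇒≤ (≤-<-trans a≤n (≤n⇒n<complement c≤n)))
      meet₂₃ : NoDescentBetween R₂ R₃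
      meet₂₃ = noDescentBetween {R₂} {R₃} (last-reverse M) refl (≤complement-a c≤n)

  upperCovers-symmetric : ∀ {a A C} → Increasing (a ∷ A) → length (a ∷ A ++ C) ≡ n →
    upperCovers n ((a ∷ A ++ C) ++ mirror (a ∷ A ++ C))
      ≡ length A + ascents (lastOf a A ∷ C ++ complement (lastOf (lastOf a A) C) ∷ [])
  upperCovers-symmetric {a} {A} {C} incA len = begin
    ascents (take (suc n) ((a ∷ A ++ C) ++ mirror (a ∷ A ++ C)))
      ≡⟨ cong ascents (take-suc-symmetric a (A ++ C) len) ⟩
    ascents ((a ∷ A ++ C) ++ complement (lastOf a (A ++ C)) ∷ [])
      ≡⟨ cong (λ w → ascents (a ∷ w)) (++-assoc A C _) ⟩
    ascents ((a ∷ A) ++ C ++ complement (lastOf a (A ++ C)) ∷ [])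
      ≡⟨ ascents-++ _ incA ⟩
    length A + ascents (lastOf a A ∷ C ++ complement (lastOf a (A ++ C)) ∷ [])
      ≡⟨ cong (λ ℓ → length A + ascents (lastOf a A ∷ C ++ complement ℓ ∷ [])) (lastOf-++ a A C) ⟩
    length A + ascents (lastOf a A ∷ C ++ complement (lastOf (lastOf a A) C) ∷ []) ∎
    where open ≡-Reasoning

  tail-ascents : ∀ {ℓ} C → BreaksAfter ℓ C → Increasing C → All (_≤ n) C → (C ≡ [] → complement ℓ ≤ ℓ) →
                 ascents (ℓ ∷ C ++ complement (lastOf ℓ C) ∷ []) ≡ length C
  tail-ascents []      _   _    _   empty = ascents-descent [] (empty refl)
  tail-ascents (c ∷ C) c≤ℓ incC C≤n _ = begin
    ascents (_ ∷ c ∷ C ++ z ∷ [])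
      ≡⟨ ascents-descent (C ++ z ∷ []) c≤ℓ ⟩
    ascents (c ∷ C ++ z ∷ [])
      ≡⟨ increasing⇒ascents≡length (increasing-++ incC [-] λ u∈ → λ { (here refl) → ≤-<-trans (All.lookup C≤n u∈) n<z }) ⟩
    length (C ++ z ∷ [])
      ≡⟨ length-++ C ⟩
    length C + 1
      ≡⟨ +-comm (length C) 1 ⟩
    suc (length C)                ∎
    where
    open ≡-Reasoning
    z : ℕ
    z = complement (lastOf c C)
    n<z : n < z
    n<z = ≤n⇒n<complement (All.lookup C≤n (lastOf-∈ c C))

  tail-ascents⁻ : ∀ {ℓ} C → BreaksAfter ℓ C → ascents (ℓ ∷ C ++ complement (lastOf ℓ C) ∷ []) ≡ length C →
                  Increasing C × All (_≤ n) C
  tail-ascents⁻ []      _   _  = [] , []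
  tail-ascents⁻ (c ∷ C) c≤ℓ eq with incC , last<z ← increasing-∷ʳ⁻ (ascents≡length⇒increasing c (C ++ _ ∷ [])
      (trans (sym (ascents-descent (C ++ _ ∷ []) c≤ℓ)) (trans eq (trans (+-comm 1 (length C)) (sym (length-++ C))))))
    = incC , All.tabulate (λ v∈ → ≤-trans (increasing-≤lastOf incC v∈) (<complement⇒≤n last<z))

  module Encoding (ρ : ℕ → Role) where

    letters : Role → List ℕ
    letters r = withRole ρ r (oneTo n)

    A C half word : List ℕ
    A    = letters inA ++ mirror (letters outside)
    C    = letters inC
    half = A ++ C
    word = half ++ mirror half

    ∈-letters⁻ : ∀ {r v} → v ∈ letters r → (1 ≤ v × v ≤ n) × ρ v ≡ r
    ∈-letters⁻ {r} v∈ with v∈oneTo , ρv≡r ← ∈-filter⁻ (λ x → ρ x ≟ᴿ r) v∈ = ∈-oneTo⁻ v∈oneTo , ρv≡r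

    ∈-letters⁺ : ∀ {r v} → 1 ≤ v → v ≤ n → ρ v ≡ r → v ∈ letters r
    ∈-letters⁺ {r} 1≤v v≤n = ∈-filter⁺ (λ x → ρ x ≟ᴿ r) (∈-oneTo⁺ 1≤v v≤n)

    letters-≤n : ∀ r → All (_≤ n) (letters r)
    letters-≤n r = All.tabulate (λ v∈ → proj₂ (proj₁ (∈-letters⁻ v∈)))

    letters-increasing : ∀ r → Increasing (letters r)
    letters-increasing r = Linked.filter⁺ (λ x → ρ x ≟ᴿ r) <-trans (oneTo-increasing n)

    A-increasing : Increasing A
    A-increasing = increasing-++ (letters-increasing inA)
      (mirror-increasing (≤n⇒≤K (letters-≤n outside)) (letters-increasing outside))
      (λ u∈ w∈ → ≤-<-trans (All.lookup (letters-≤n inA) u∈) (n<mirror (letters-≤n outside) w∈))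

    A-letters : ∀ {w} → w ∈ A → Letter w
    A-letters w∈A with ∈-++⁻ (letters inA) w∈A
    ... | inj₁ w∈ = let ((1≤w , w≤n) , _) = ∈-letters⁻ w∈ in 1≤w , ≤-trans w≤n n≤2n
    ... | inj₂ w∈ with u , u∈ , refl ← ∈-mirror⁻ (letters outside) w∈ =
      let ((1≤u , u≤n) , _) = ∈-letters⁻ u∈ in complement-letter (1≤u , ≤-trans u≤n n≤2n)

    A-bounded : All (_≤ suc (2 * n)) A
    A-bounded = All.tabulate (letter-≤ ∘ A-letters)

    ∈A⇒inA : ∀ {v} → v ∈ A → v ≤ n → ρ v ≡ inA
    ∈A⇒inA v∈A v≤n with ∈-++⁻ (letters inA) v∈A
    ... | inj₁ v∈ = proj₂ (∈-letters⁻ v∈)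
    ... | inj₂ v∈ = contradiction (n<mirror (letters-≤n outside) v∈) (≤⇒≯ v≤n)

    ∉A : ∀ {v r} → v ≤ n → ρ v ≡ r → r ≢ inA → v ∉ A
    ∉A v≤n ρv≡r r≢inA v∈A = r≢inA (trans (sym ρv≡r) (∈A⇒inA v∈A v≤n))

    ∉letters : ∀ {v r r′} → ρ v ≡ r → r ≢ r′ → v ∉ letters r′
    ∉letters ρv≡r r≢r′ v∈ = r≢r′ (trans (sym ρv≡r) (proj₂ (∈-letters⁻ v∈)))

    roleIn-encoding : ∀ {v} → 1 ≤ v → v ≤ n → roleIn A C v ≡ ρ v
    roleIn-encoding {v} 1≤v v≤n with ρ v in ρv
    ... | inA     = roleIn-inA (∈-++⁺ˡ (∈-letters⁺ 1≤v v≤n ρv))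
    ... | inC     = roleIn-inC (∉A v≤n ρv λ ()) (∈-letters⁺ 1≤v v≤n ρv)
    ... | outside = roleIn-outside (∉A v≤n ρv λ ()) (∉letters ρv λ ())

    mirror-half : mirror half ≡ mirror (letters inC) ++ letters outside ++ mirror (letters inA)
    mirror-half = begin
      mirror (A ++ C)
        ≡⟨ mirror-++ A C ⟩
      mirror C ++ mirror A
        ≡⟨ cong (mirror C ++_) (mirror-++ (letters inA) _) ⟩
      mirror C ++ mirror (mirror (letters outside)) ++ mirror (letters inA)
        ≡⟨ cong (λ w → mirror C ++ w ++ mirror (letters inA)) (mirror-involutive (≤n⇒≤K (letters-≤n outside))) ⟩
      mirror C ++ letters outside ++ mirror (letters inA) ∎
      where open ≡-Reasoning

    word-↭ : word ↭ oneTo (2 * n)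
    word-↭ = begin
      half ++ mirror half
        ≡⟨ cong (half ++_) mirror-half ⟩
      ((a ++ m̅o) ++ c) ++ m̅c ++ o ++ m̅a
        ↭⟨ solve 6 (λ a m̅o c m̅c o m̅a → ((a ⊕ m̅o) ⊕ c) ⊕ (m̅c ⊕ (o ⊕ m̅a)) ⊜ (a ⊕ (c ⊕ o)) ⊕ ((m̅o ⊕ m̅c) ⊕ m̅a)) ↭-refl a m̅o c m̅c o m̅a ⟩
      (a ++ c ++ o) ++ (m̅o ++ m̅c) ++ m̅a
        ≡⟨ cong ((a ++ c ++ o) ++_) (trans (cong (_++ m̅a) (sym (mirror-++ c o))) (sym (mirror-++ a (c ++ o)))) ⟩
      (a ++ c ++ o) ++ mirror (a ++ c ++ o)
        ↭⟨ ++⁺ (withRole-↭ ρ (oneTo n)) (mirror-↭ (withRole-↭ ρ (oneTo n))) ⟩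
      oneTo n ++ mirror (oneTo n)
        ≡⟨ oneTo-double ⟩
      oneTo (2 * n)                    ∎
      where
      open PermutationReasoning
      a c o m̅a m̅c m̅o : List ℕ
      a = letters inA
      c = letters inC
      o = letters outside
      m̅a = mirror a
      m̅c = mirror c
      m̅o = mirror o

    length-half : length half ≡ n
    length-half = *-cancelˡ-≡ (length half) n 2 (begin
      2 * length half                         ≡⟨ cong (length half +_) (+-identityʳ (length half)) ⟩
      length half + length half               ≡⟨ cong (length half +_) (length-mirror half) ⟨
      length half + length (mirror half)      ≡⟨ length-++ half ⟨
      length word                             ≡⟨ ↭-length word-↭ ⟩
      length (oneTo (2 * n))                  ≡⟨ length-oneTo (2 * n) ⟩
      2 * n                                   ∎)
      where open ≡-Reasoning

  -- t lists the roles of the letters 1, …, n in this order.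
  roleOf : List Role → ℕ → Role
  roleOf t v = nthOr outside t (v ∸ 1)

  encode : List Role → List ℕ
  encode t = Encoding.word (roleOf t)

  splitHalf : List ℕ → List ℕ × List ℕ
  splitHalf []      = [] , []
  splitHalf (a ∷ h) = map₁ (a ∷_) (increasingPrefix a h)

  rolesOf : List ℕ × List ℕ → List Role
  rolesOf (A , C) = applyUpTo (roleIn A C ∘ suc) n

  decode : List ℕ → List Role
  decode x = rolesOf (splitHalf (take n x))

  Admissible : ℕ → (ℕ → Role) → Set
  Admissible i ρ = ∀ {v} → 1 ≤ v → v ≤ n → ρ v ∈ allowedRoles i v

  module AdmissibleEncoding {i} (1<i : 1 < i) (i≤n : i ≤ n) {ρ} (admissible : Admissible i ρ) where

    open Encoding ρ

    1≤n : 1 ≤ n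
    1≤n = ≤-trans (<⇒≤ 1<i) i≤n

    ρ-i : ρ i ≡ inA
    ρ-i with <-cmp i i | admissible (<⇒≤ 1<i) i≤n
    ... | tri< _ i≢i _ | _          = contradiction refl i≢i
    ... | tri≈ _ _ _   | here ρi≡   = ρi≡
    ... | tri> _ i≢i _ | _          = contradiction refl i≢i

    ρ-below : ∀ {v} → 1 ≤ v → v < i → ρ v ≡ outside ⊎ ρ v ≡ inC
    ρ-below {v} 1≤v v<i with <-cmp v i | admissible 1≤v (≤-trans (<⇒≤ v<i) i≤n)
    ... | tri< _ _ _   | here ρv≡         = inj₁ ρv≡
    ... | tri< _ _ _   | there (here ρv≡) = inj₂ ρv≡
    ... | tri≈ v≮i _ _ | _                = contradiction v<i v≮i
    ... | tri> v≮i _ _ | _                = contradiction v<i v≮i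

    i∈A : i ∈ A
    i∈A = ∈-++⁺ˡ (∈-letters⁺ (<⇒≤ 1<i) i≤n ρ-i)

    i≤A : ∀ {w} → w ∈ A → i ≤ w
    i≤A {w} w∈A with w ≤? n
    ... | no  w≰n = ≤-trans i≤n (<⇒≤ (≰⇒> w≰n))
    ... | yes w≤n with i ≤? w
    ...   | yes i≤w = i≤w
    ...   | no  i≰w with ρ-below (proj₁ (A-letters w∈A)) (≰⇒> i≰w)
    ...     | inj₁ ρw≡outside = contradiction w∈A (∉A w≤n ρw≡outside λ ())
    ...     | inj₂ ρw≡inC     = contradiction w∈A (∉A w≤n ρw≡inC λ ())

    A′ : List ℕ
    A′ = proj₁ (increasing-minimum A-increasing i∈A i≤A)

    A≡ : A ≡ i ∷ A′
    A≡ = proj₂ (increasing-minimum A-increasing i∈A i≤A)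

    ℓ : ℕ
    ℓ = lastOf i A′

    incA′ : Increasing (i ∷ A′)
    incA′ = subst Increasing A≡ A-increasing

    A′-letters : ∀ {w} → w ∈ i ∷ A′ → Letter w
    A′-letters w∈ = A-letters (subst (_ ∈_) (sym A≡) w∈)

    1∈C⊎ℓ≡2n : 1 ∈ C ⊎ ℓ ≡ 2 * n
    1∈C⊎ℓ≡2n with ρ-below ≤-refl 1<i
    ... | inj₂ ρ1≡inC     = inj₁ (∈-letters⁺ ≤-refl 1≤n ρ1≡inC)
    ... | inj₁ ρ1≡outside = inj₂ (≤-antisym (proj₂ (A′-letters (lastOf-∈ i A′)))
                                  (increasing-≤lastOf incA′ (subst (2 * n ∈_) A≡ 2n∈A)))
      where
      2n∈A : 2 * n ∈ A
      2n∈A = ∈-++⁺ʳ (letters inA) (∈-mirror⁺ (∈-letters⁺ ≤-refl 1≤n ρ1≡outside))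

    breaks : BreaksAfter ℓ C
    breaks with 1∈C⊎ℓ≡2n
    ... | inj₁ 1∈C = breaksAfter-head (letters-increasing inC) 1∈C (≤-trans (<⇒≤ 1<i) (increasing-≤lastOf incA′ (here refl)))
    ... | inj₂ ℓ≡2n = breaksAfter-all (All.map (λ c≤n → ≤-trans c≤n (≤-trans n≤2n (≤-reflexive (sym ℓ≡2n)))) (letters-≤n inC))

    word≡ : word ≡ (i ∷ A′ ++ C) ++ mirror (i ∷ A′ ++ C)
    word≡ = cong (λ w → (w ++ C) ++ mirror (w ++ C)) A≡

    length-i∷A′++C : length (i ∷ A′ ++ C) ≡ n
    length-i∷A′++C = trans (cong (λ w → length (w ++ C)) (sym A≡)) length-half

    head-word : head word ≡ just i
    head-word = cong head word≡

    upperCovers-word : upperCovers n word ≡ n ∸ 1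
    upperCovers-word = begin
      upperCovers n word
        ≡⟨ cong (upperCovers n) word≡ ⟩
      upperCovers n ((i ∷ A′ ++ C) ++ mirror (i ∷ A′ ++ C))
        ≡⟨ upperCovers-symmetric incA′ length-i∷A′++C ⟩
      length A′ + ascents (ℓ ∷ C ++ complement (lastOf ℓ C) ∷ [])
        ≡⟨ cong (length A′ +_) (tail-ascents C breaks (letters-increasing inC) (letters-≤n inC) no-C) ⟩
      length A′ + length C
        ≡⟨ length-++ A′ ⟨
      length (A′ ++ C)
        ≡⟨ cong (_∸ 1) length-i∷A′++C ⟩
      n ∸ 1                                                                 ∎
      where
      open ≡-Reasoning
      no-C : C ≡ [] → complement ℓ ≤ ℓ
      no-C C≡[] with 1∈C⊎ℓ≡2n
      ... | inj₁ 1∈C  with () ← subst (1 ∈_) C≡[] 1∈C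
      ... | inj₂ ℓ≡2n rewrite ℓ≡2n | complement-2n = ≤-trans (<⇒≤ 1<i) (≤-trans i≤n n≤2n)

    word-image : InPopImage n word
    word-image = y , self-mirror⇒B y↭ (popPreimage-self-mirror A′-bounded (≤n⇒≤K (letters-≤n inC))) , pop-y
      where
      y : List ℕ
      y = popPreimage (i ∷ A′) C
      A′-bounded : All (_≤ suc (2 * n)) (i ∷ A′)
      A′-bounded = subst (All (_≤ suc (2 * n))) A≡ A-bounded
      pop-y : pop y ≡ word
      pop-y = trans (pop-popPreimage incA′ A′-bounded i≤n (letters-increasing inC) (letters-≤n inC)) (sym word≡)
      y↭ : y ↭ oneTo (2 * n)
      y↭ = ↭-trans (↭-sym (pop-↭ y)) (↭-trans (↭-reflexive pop-y) word-↭)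

    decode-word : decode word ≡ applyUpTo (ρ ∘ suc) n
    decode-word = begin
      rolesOf (splitHalf (take n word))
        ≡⟨ cong (rolesOf ∘ splitHalf) take-word ⟩
      rolesOf (splitHalf (i ∷ A′ ++ C))
        ≡⟨ cong (rolesOf ∘ map₁ (i ∷_)) (increasingPrefix-unique (incA′ , breaks)) ⟩
      applyUpTo (roleIn (i ∷ A′) C ∘ suc) n
        ≡⟨ applyUpTo-cong n (λ k<n → trans (cong (λ w → roleIn w C _) (sym A≡)) (roleIn-encoding (s≤s z≤n) k<n)) ⟩
      applyUpTo (ρ ∘ suc) n                    ∎
      where
      open ≡-Reasoning
      take-word : take n word ≡ i ∷ A′ ++ C
      take-word = begin
        take n word
          ≡⟨ cong (λ k → take k word) (trans (sym length-half) (sym (+-identityʳ _))) ⟩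
        take (length half + 0) (half ++ mirror half)
          ≡⟨ take-++-length half (mirror half) 0 ⟩
        half ++ []
          ≡⟨ ++-identityʳ half ⟩
        half
          ≡⟨ cong (_++ C) A≡ ⟩
        i ∷ A′ ++ C                                               ∎

  module Reconstruction {A C : List ℕ} (incA : Increasing A) (incC : Increasing C) (C≤n : All (_≤ n) C)
                        (h↭ : (A ++ C) ++ mirror (A ++ C) ↭ oneTo (2 * n))
                        {σ : ℕ → Role} (σ≡ : ∀ {v} → 1 ≤ v → v ≤ n → σ v ≡ roleIn A C v) where

    private
      module E = Encoding σ
      h : List ℕ
      h = A ++ C

    h-unique : Unique (h ++ mirror h)
    h-unique = PermutationₛProperties.Unique-resp-↭ (↭⇒↭ₛ (↭-sym h↭)) (increasing-unique (oneTo-increasing (2 * n)))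

    h-letters : ∀ {v} → v ∈ h → Letter v
    h-letters v∈h = ∈-oneTo⁻ (∈-resp-↭ h↭ (∈-++⁺ˡ v∈h))

    h-covers : ∀ {v} → Letter v → v ∈ h ⊎ v ∈ mirror h
    h-covers (1≤v , v≤2n) = ∈-++⁻ h (∈-resp-↭ (↭-sym h↭) (∈-oneTo⁺ 1≤v v≤2n))

    ∉A∪C⇒complement∈h : ∀ {u} → Letter u → u ∉ A → u ∉ C → complement u ∈ h
    ∉A∪C⇒complement∈h {u} u-letter u∉A u∉C with h-covers u-letter
    ... | inj₁ u∈h with ∈-++⁻ A u∈h
    ...   | inj₁ u∈A = contradiction u∈A u∉A
    ...   | inj₂ u∈C = contradiction u∈C u∉C
    ∉A∪C⇒complement∈h {u} u-letter u∉A u∉C | inj₂ u∈m̅h with w , w∈h , refl ← ∈-mirror⁻ h u∈m̅h =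
      subst (_∈ h) (sym (complement-involutive (letter-≤ (h-letters w∈h)))) w∈h

    A-reconstructed : E.A ≡ A
    A-reconstructed = increasing-≡ E.A-increasing incA sub sup
      where
      sub : ∀ {v} → v ∈ E.A → v ∈ A
      sub v∈ with ∈-++⁻ (E.letters inA) v∈
      ... | inj₁ v∈a = let ((1≤v , v≤n) , σv) = E.∈-letters⁻ v∈a in roleIn≡inA (trans (sym (σ≡ 1≤v v≤n)) σv)
      ... | inj₂ v∈m̅o with u , u∈o , refl ← ∈-mirror⁻ (E.letters outside) v∈m̅o
        with ((1≤u , u≤n) , σu) ← E.∈-letters⁻ u∈o
        with u∉A , u∉C ← roleIn≡outside (trans (sym (σ≡ 1≤u u≤n)) σu)
        with ∈-++⁻ A (∉A∪C⇒complement∈h (1≤u , ≤-trans u≤n n≤2n) u∉A u∉C)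
      ...   | inj₁ u̅∈A = u̅∈A
      ...   | inj₂ u̅∈C = contradiction (All.lookup C≤n u̅∈C) (<⇒≱ (≤n⇒n<complement u≤n))
      sup : ∀ {v} → v ∈ A → v ∈ E.A
      sup {v} v∈A with h-letters (∈-++⁺ˡ v∈A) | v ≤? n
      ... | 1≤v , _ | yes v≤n = ∈-++⁺ˡ (E.∈-letters⁺ 1≤v v≤n (trans (σ≡ 1≤v v≤n) (roleIn-inA v∈A)))
      ... | v-letter | no v≰n =
        ∈-++⁺ʳ (E.letters inA) (subst (_∈ mirror (E.letters outside)) (complement-involutive (letter-≤ v-letter))
          (∈-mirror⁺ (E.∈-letters⁺ 1≤v̅ v̅≤n (trans (σ≡ 1≤v̅ v̅≤n) (roleIn-outside (v̅∉h ∘ ∈-++⁺ˡ) (v̅∉h ∘ ∈-++⁺ʳ A))))))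
        where
        1≤v̅ : 1 ≤ complement v
        1≤v̅ = proj₁ (complement-letter v-letter)
        v̅≤n : complement v ≤ n
        v̅≤n = n<⇒complement≤n (≰⇒> v≰n)
        v̅∉h : complement v ∉ h
        v̅∉h v̅∈h = unique-++-disjoint h-unique (∈-++⁺ˡ v∈A)
          (subst (_∈ mirror h) (complement-involutive (letter-≤ v-letter)) (∈-mirror⁺ v̅∈h))

    C-reconstructed : E.C ≡ C
    C-reconstructed = increasing-≡ (E.letters-increasing inC) incC sub sup
      where
      sub : ∀ {v} → v ∈ E.C → v ∈ C
      sub v∈ = let ((1≤v , v≤n) , σv) = E.∈-letters⁻ v∈ in roleIn≡inC (trans (sym (σ≡ 1≤v v≤n)) σv)
      sup : ∀ {v} → v ∈ C → v ∈ E.C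
      sup {v} v∈C = E.∈-letters⁺ 1≤v v≤n (trans (σ≡ 1≤v v≤n) (roleIn-inC v∉A v∈C))
        where
        1≤v : 1 ≤ v
        1≤v = proj₁ (h-letters (∈-++⁺ʳ A v∈C))
        v≤n : v ≤ n
        v≤n = All.lookup C≤n v∈C
        v∉A : v ∉ A
        v∉A v∈A = unique-++-disjoint (unique-++ˡ h-unique) v∈A v∈C

    word-reconstructed : E.word ≡ h ++ mirror h
    word-reconstructed = cong (λ w → w ++ mirror w) (cong₂ _++_ A-reconstructed C-reconstructed)

  half-∷ : ∀ {h i} → head (h ++ mirror h) ≡ just i → ∃ λ h′ → h ≡ i ∷ h′
  half-∷ {a ∷ h} refl = h , refl

  module Decomposition {i x} (x-image : InPopImage n x) (head-x : head x ≡ just i) (upper-x : upperCovers n x ≡ n ∸ 1) where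

    private
      y : List ℕ
      y = proj₁ x-image
      y-B : B n y
      y-B = proj₁ (proj₂ x-image)
      pop-y : pop y ≡ x
      pop-y = proj₂ (proj₂ x-image)

    x↭ : x ↭ oneTo (2 * n)
    x↭ = ↭-trans (↭-reflexive (sym pop-y)) (↭-trans (pop-↭ y) (proj₁ y-B))

    mirror-x : mirror x ≡ x
    mirror-x = begin
      mirror x        ≡⟨ cong mirror (sym pop-y) ⟩
      mirror (pop y)  ≡⟨ pop-mirror y (All-resp-↭ (↭-sym (proj₁ y-B)) (oneTo-bounded (2 * n) (n≤1+n _))) ⟨
      pop (mirror y)  ≡⟨ cong pop (B⇒self-mirror y-B) ⟩
      pop y           ≡⟨ pop-y ⟩
      x               ∎
      where open ≡-Reasoning

    length-x : length x ≡ 2 * n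
    length-x = trans (↭-length x↭) (length-oneTo (2 * n))

    x≡halves : x ≡ take n x ++ mirror (take n x)
    x≡halves = symmetric-halves mirror-x length-x

    h′ : List ℕ
    h′ = proj₁ (half-∷ {take n x} (subst (λ w → head w ≡ just i) x≡halves head-x))

    take-x : take n x ≡ i ∷ h′
    take-x = proj₂ (half-∷ {take n x} (subst (λ w → head w ≡ just i) x≡halves head-x))

    A′ C : List ℕ
    A′ = proj₁ (increasingPrefix i h′)
    C  = proj₂ (increasingPrefix i h′)

    h′≡ : h′ ≡ A′ ++ C
    h′≡ = proj₁ (increasingPrefix-correct i h′)

    incA′ : Increasing (i ∷ A′)
    incA′ = proj₁ (proj₂ (increasingPrefix-correct i h′))

    breaks : BreaksAfter (lastOf i A′) C
    breaks = proj₂ (proj₂ (increasingPrefix-correct i h′))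

    x≡ : x ≡ (i ∷ A′ ++ C) ++ mirror (i ∷ A′ ++ C)
    x≡ = trans x≡halves (cong (λ w → w ++ mirror w) (trans take-x (cong (i ∷_) h′≡)))

    length-i∷A′++C : length (i ∷ A′ ++ C) ≡ n
    length-i∷A′++C = trans (cong length (sym (trans take-x (cong (i ∷_) h′≡))))
                       (trans (length-take n x) (trans (cong (n ⊓_) length-x) (m≤n⇒m⊓n≡m n≤2n)))

    C-facts : Increasing C × All (_≤ n) C
    C-facts = tail-ascents⁻ C breaks (+-cancelˡ-≡ (length A′) _ _ (begin
      length A′ + ascents (lastOf i A′ ∷ C ++ complement (lastOf (lastOf i A′) C) ∷ [])
        ≡⟨ upperCovers-symmetric {C = C} incA′ length-i∷A′++C ⟨
      upperCovers n ((i ∷ A′ ++ C) ++ mirror (i ∷ A′ ++ C))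
        ≡⟨ cong (upperCovers n) x≡ ⟨
      upperCovers n x
        ≡⟨ upper-x ⟩
      n ∸ 1
        ≡⟨ cong (_∸ 1) length-i∷A′++C ⟨
      length (A′ ++ C)
        ≡⟨ length-++ A′ ⟩
      length A′ + length C                                  ∎))
      where open ≡-Reasoning

    decode-x : decode x ≡ rolesOf (i ∷ A′ , C)
    decode-x = cong (rolesOf ∘ splitHalf) take-x

    decode-admissible : decode x ∈ roleAssignments n i
    decode-admissible = subst (_∈ roleAssignments n i) (sym decode-x)
      (∈-sequences-applyUpTo⁺ n (λ _ → roleIn-allowed (here refl) (increasing-head≤ incA′)))

    encode-decode : encode (decode x) ≡ x
    encode-decode = trans (Reconstruction.word-reconstructed incA′ (proj₁ C-facts) (proj₂ C-facts)
                      (subst (_↭ oneTo (2 * n)) x≡ x↭) roleOf-decode) (sym x≡)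
      where
      roleOf-decode : ∀ {v} → 1 ≤ v → v ≤ n → roleOf (decode x) v ≡ roleIn (i ∷ A′) C v
      roleOf-decode {suc k} _ k<n = trans (cong (λ t → nthOr outside t k) decode-x) (nthOr-applyUpTo (roleIn (i ∷ A′) C ∘ suc) k<n)

  roleAssignment-admissible : ∀ {i t} → t ∈ roleAssignments n i → Admissible i (roleOf t)
  roleAssignment-admissible t∈ {suc k} _ k<n = proj₂ (∈-sequences-applyUpTo⁻ n t∈) k<n

  decode-encode : ∀ {i t} → 1 < i → i ≤ n → t ∈ roleAssignments n i → decode (encode t) ≡ t
  decode-encode 1<i i≤n t∈ =
    trans (AdmissibleEncoding.decode-word 1<i i≤n (roleAssignment-admissible t∈)) (proj₁ (∈-sequences-applyUpTo⁻ n t∈))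

  Counted : ℕ → List ℕ → Set
  Counted i x = InPopImage n x × head x ≡ just i × upperCovers n x ≡ n ∸ 1

  encode-enumerates : ∀ {i} → 1 < i → i ≤ n →
    Unique (map encode (roleAssignments n i)) × (∀ x → x ∈ map encode (roleAssignments n i) ⇔ Counted i x)
  encode-enumerates {i} 1<i i≤n = enumeration (roleAssignments n i) encode decode (roleAssignments-unique n i)
    (λ t∈ → let open AdmissibleEncoding 1<i i≤n (roleAssignment-admissible t∈) in word-image , head-word , upperCovers-word)
    (decode-encode 1<i i≤n)
    (λ (x-image , head-x , upper-x) → Decomposition.decode-admissible x-image head-x upper-x)
    (λ (x-image , head-x , upper-x) → Decomposition.encode-decode x-image head-x upper-x)

mainTheorem8 : (n i : ℕ) → 2 ≤ n → 2 ≤ i → i ≤ n →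
    Σ (List (List ℕ)) (λ L → Unique L × (length L ≡ 2 ^ (i ∸ 1) * 3 ^ (n ∸ i)) ×
      ((x : List ℕ) → (x ∈ L) ⇔ (InPopImage n x × (head x ≡ just i) × (upperCovers n x ≡ n ∸ 1))))
mainTheorem8 n i _ 2≤i i≤n =
    map encode (roleAssignments n i)
  , proj₁ (encode-enumerates 2≤i i≤n)
  , trans (length-map encode (roleAssignments n i)) (length-roleAssignments n i (<⇒≤ 2≤i) i≤n)
  , proj₂ (encode-enumerates 2≤i i≤n)
  where open TypeB n
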